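{- For every graph $G$, we have $\alpha\text{ - }\mathrm{pw}(s(G)) = \alpha\text{ - }\mathrm{pw}(G)+1$.
   Context: All graphs are finite, simple and undirected. For a graph $G$, $\alpha(G)$ denotes the independence number. A path decomposition of $G$ is a pair $(P,\beta)$ where $P$ is a path and $\beta$ assigns to each node $x$ of $P$ a set $\beta(x)\subseteq V(G)$ (a bag) such that every vertex lies in some bag, both endpoints of every edge lie in a common bag, and for every vertex $v$ the nodes whose bags contain $v$ form a subpath of $P$. The $\alpha$-pathwidth (path-independence number) $\alpha\text{ - }\mathrm{pw}(G)$ is the minimum, over all path decompositions $(P,\beta)$ of $G$, of $\max_{x\in V(P)} \alpha(G[\beta(x)])$. The s-claw substitution $s(G)$ of $G$ is the graph obtained from the disjoint union of three copies $G_1,G_2,G_3$ of $G$ by adding three new vertices $v_1,v_2,v_3$, making each $v_i$ adjacent to all vertices of $G_i$, and adding a fourth new vertex $w$ adjacent precisely to $v_1,v_2,v_3$. -}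

module Defs where

open import Data.Nat using (ℕ; zero; suc; _+_) renaming (_≤_ to _≤ℕ_; _<_ to _<ℕ_)
open import Data.Bool using (Bool; true; false; _∧_)
open import Data.Fin using (Fin; zero; suc; splitAt; _≤_)
open import Data.Fin.Subset using (Subset; _∈_; _⊆_; ∣_∣)
open import Data.Sum using (_⊎_; inj₁; inj₂)
open import Data.Product using (_×_; _,_; ∃; ∃-syntax)
open import Relation.Nullary using (¬_)
open import Relation.Binary.PropositionalEquality using (_≡_; refl; sym; trans; cong₂)

record Graph : Set where
  field
    n      : ℕ
    adj    : Fin n → Fin n → Bool
    adj-sym     : ∀ u v → adj u v ≡ adj v u
    adj-irrefl  : ∀ v → adj v v ≡ false
open Graph public

Independent : (G : Graph) → Subset (n G) → Set
Independent G S = ∀ u v → u ∈ S → v ∈ S → adj G u v ≡ false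

AlphaInducedAtMost : (G : Graph) → Subset (n G) → ℕ → Set
AlphaInducedAtMost G B k = ∀ (S : Subset (n G)) → S ⊆ B → Independent G S → ∣ S ∣ ≤ℕ k

record PathDecomposition (G : Graph) : Set where
  field
    len   : ℕ
    bag   : Fin (suc len) → Subset (n G)
    vertex-cover : ∀ v → ∃[ x ] v ∈ bag x
    edge-cover   : ∀ u v → adj G u v ≡ true → ∃[ x ] (u ∈ bag x × v ∈ bag x)
    contiguous   : ∀ v (x y z : Fin (suc len)) → x ≤ y → y ≤ z →
                   v ∈ bag x → v ∈ bag z → v ∈ bag y
open PathDecomposition public

AlphaWidthAtMost : {G : Graph} → PathDecomposition G → ℕ → Set
AlphaWidthAtMost {G} D k = ∀ x → AlphaInducedAtMost G (bag D x) k

AlphaPw : Graph → ℕ → Set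
AlphaPw G k =
  (∃[ D ] AlphaWidthAtMost {G} D k) ×
  (∀ (D : PathDecomposition G) (j : ℕ) → j <ℕ k → ¬ AlphaWidthAtMost {G} D j)

data Three : Set where
  c₁ c₂ c₃ : Three

same : Three → Three → Bool
same c₁ c₁ = true
same c₂ c₂ = true
same c₃ c₃ = true
same _  _  = false

same-sym : ∀ i j → same i j ≡ same j i
same-sym c₁ c₁ = refl
same-sym c₁ c₂ = refl
same-sym c₁ c₃ = refl
same-sym c₂ c₁ = refl
same-sym c₂ c₂ = refl
same-sym c₂ c₃ = refl
same-sym c₃ c₁ = refl
same-sym c₃ c₂ = refl
same-sym c₃ c₃ = refl

-- vertices of s(G): copy i v is vertex v of G_i, hub i is v_i, centre is w
data SVertex (m : ℕ) : Set where
  copy   : Three → Fin m → SVertex m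
  hub    : Three → SVertex m
  centre : SVertex m

sAdjV : (G : Graph) → SVertex (n G) → SVertex (n G) → Bool
sAdjV G (copy i u) (copy j v) = same i j ∧ adj G u v
sAdjV G (copy i u) (hub j)    = same i j
sAdjV G (copy i u) centre     = false
sAdjV G (hub i)    (copy j v) = same i j
sAdjV G (hub i)    (hub j)    = false
sAdjV G (hub i)    centre     = true
sAdjV G centre     (copy j v) = false
sAdjV G centre     (hub j)    = true
sAdjV G centre     centre     = false

sAdjV-sym : ∀ G x y → sAdjV G x y ≡ sAdjV G y x
sAdjV-sym G (copy i u) (copy j v) = cong₂ _∧_ (same-sym i j) (adj-sym G u v)
sAdjV-sym G (copy i u) (hub j)    = same-sym i j
sAdjV-sym G (copy i u) centre     = refl
sAdjV-sym G (hub i)    (copy j v) = same-sym i j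
sAdjV-sym G (hub i)    (hub j)    = refl
sAdjV-sym G (hub i)    centre     = refl
sAdjV-sym G centre     (copy j v) = refl
sAdjV-sym G centre     (hub j)    = refl
sAdjV-sym G centre     centre     = refl

sAdjV-irrefl : ∀ G x → sAdjV G x x ≡ false
sAdjV-irrefl G (copy c₁ u) = adj-irrefl G u
sAdjV-irrefl G (copy c₂ u) = adj-irrefl G u
sAdjV-irrefl G (copy c₃ u) = adj-irrefl G u
sAdjV-irrefl G (hub i)     = refl
sAdjV-irrefl G centre      = refl

hubOrCentre : ∀ {m} → Fin 4 → SVertex m
hubOrCentre zero                   = hub c₁
hubOrCentre (suc zero)             = hub c₂
hubOrCentre (suc (suc zero))       = hub c₃
hubOrCentre (suc (suc (suc zero))) = centre

decode : ∀ m → Fin (m + m + m + 4) → SVertex m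
decode m x with splitAt (m + m + m) x
... | inj₂ j = hubOrCentre j
... | inj₁ y with splitAt (m + m) y
...   | inj₂ v = copy c₃ v
...   | inj₁ z with splitAt m z
...     | inj₁ v = copy c₁ v
...     | inj₂ v = copy c₂ v

sClaw : Graph → Graph
sClaw G = record
  { n          = n G + n G + n G + 4
  ; adj        = λ x y → sAdjV G (decode (n G) x) (decode (n G) y)
  ; adj-sym    = λ x y → sAdjV-sym G (decode (n G) x) (decode (n G) y)
  ; adj-irrefl = λ x → sAdjV-irrefl G (decode (n G) x)
  }

module Submission where

-- Upper bound: concatenate three copies of an optimal path decomposition of G, the i-th one
-- with v_i and w added to every bag.  An independent set in such a bag is either {v_i}, which
-- sees everything else there, or an independent set of a bag of G plus possibly w.
-- Lower bound: restricting a path decomposition of s(G) to each copy G_i yields a bag x_i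
-- containing an independent set of G_i of size α-pw(G).  If x_j lies between x_i and x_l, the
-- walk G_i, v_i, w, v_l, G_l meets the bag x_j in a vertex with no neighbour in G_j, which
-- enlarges that independent set.

open import Data.Bool using (Bool; true; false; _∧_; if_then_else_)
open import Data.Empty using (⊥-elim)
open import Data.Unit using (⊤; tt)
open import Data.Fin as Fin using (Fin; zero; suc; toℕ; splitAt; _↑ˡ_; _↑ʳ_; combine; quotient; remainder)
open import Data.Fin.Properties
  using (≤-total; ≤-antisym; combine-monoˡ-<; toℕ-combine; combine-remQuot; remQuot-combine;
         splitAt-↑ˡ; splitAt-↑ʳ; splitAt⁻¹-↑ˡ; splitAt⁻¹-↑ʳ)
open import Data.Fin.Subset using (Subset; _∈_; _∉_; _⊆_; ∣_∣; _∪_; ⁅_⁆; Nonempty) renaming (⊥ to ∅)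
open import Data.Fin.Subset.Properties
  using (_∈?_; x∈⁅x⁆; x∈⁅y⁆⇒x≡y; x∈p∪q⁻; x∈p∪q⁺; p⊆p∪q; p⊂q⇒∣p∣<∣q∣; p⊆q⇒∣p∣≤∣q∣; ∣⁅x⁆∣≡1; ∣⊥∣≡0)
open import Data.Nat using (ℕ; zero; suc; _+_; _*_; _≤_; _<_; _≤?_; z≤n; s≤s)
open import Data.Nat.Properties
  using (≤-refl; ≤-trans; ≰⇒>; <⇒≱; +-suc; +-comm; +-identityʳ; +-monoʳ-≤; +-cancelˡ-≤; n≤1+n)
open import Data.Product using (_×_; _,_; ∃-syntax; proj₁; proj₂; map; map₂)
open import Data.Sum using (_⊎_; inj₁; inj₂)
open import Data.Vec using (_∷_; []; _++_; lookup; tabulate; here; there)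
open import Data.Vec.Properties using (lookup∘tabulate; lookup-++ˡ; lookup-++ʳ; lookup-replicate; []=⇒lookup; lookup⇒[]=)
open import Relation.Binary.PropositionalEquality using (_≡_; refl; sym; trans; cong; subst; subst₂; _≢_; module ≡-Reasoning)
open ≡-Reasoning
open import Relation.Nullary using (¬_; yes; no)
open import Function using (_∘_)

open import Defs

∈-tabulate⁺ : ∀ {a} {f : Fin a → Bool} {v} → f v ≡ true → v ∈ tabulate f
∈-tabulate⁺ {f = f} {v} fv = lookup⇒[]= v _ (trans (lookup∘tabulate f v) fv)

∈-tabulate⁻ : ∀ {a} {f : Fin a → Bool} {v} → v ∈ tabulate f → f v ≡ true
∈-tabulate⁻ {f = f} {v} v∈ = trans (sym (lookup∘tabulate f v)) ([]=⇒lookup v∈)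

∣p++q∣≡∣p∣+∣q∣ : ∀ {a b} (p : Subset a) (q : Subset b) → ∣ p ++ q ∣ ≡ ∣ p ∣ + ∣ q ∣
∣p++q∣≡∣p∣+∣q∣ []          q = refl
∣p++q∣≡∣p∣+∣q∣ (true ∷ p)  q = cong suc (∣p++q∣≡∣p∣+∣q∣ p q)
∣p++q∣≡∣p∣+∣q∣ (false ∷ p) q = ∣p++q∣≡∣p∣+∣q∣ p q

∣p∪q∣≤∣p∣+∣q∣ : ∀ {a} (p q : Subset a) → ∣ p ∪ q ∣ ≤ ∣ p ∣ + ∣ q ∣
∣p∪q∣≤∣p∣+∣q∣ []          []          = z≤n
∣p∪q∣≤∣p∣+∣q∣ (true ∷ p)  (true ∷ q)  = s≤s (≤-trans (∣p∪q∣≤∣p∣+∣q∣ p q) (+-monoʳ-≤ ∣ p ∣ (n≤1+n ∣ q ∣)))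
∣p∪q∣≤∣p∣+∣q∣ (true ∷ p)  (false ∷ q) = s≤s (∣p∪q∣≤∣p∣+∣q∣ p q)
∣p∪q∣≤∣p∣+∣q∣ (false ∷ p) (true ∷ q)  = subst (suc ∣ p ∪ q ∣ ≤_) (sym (+-suc ∣ p ∣ ∣ q ∣)) (s≤s (∣p∪q∣≤∣p∣+∣q∣ p q))
∣p∪q∣≤∣p∣+∣q∣ (false ∷ p) (false ∷ q) = ∣p∪q∣≤∣p∣+∣q∣ p q

x∉p⇒∣p∣<∣p∪⁅x⁆∣ : ∀ {a} {p : Subset a} {x} → x ∉ p → ∣ p ∣ < ∣ p ∪ ⁅ x ⁆ ∣
x∉p⇒∣p∣<∣p∪⁅x⁆∣ {x = x} x∉p = p⊂q⇒∣p∣<∣q∣ (p⊆p∪q ⁅ x ⁆ , x , x∈p∪q⁺ (inj₂ (x∈⁅x⁆ x)) , x∉p)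

∣p∣>0⇒nonempty : ∀ {a} (p : Subset a) → 0 < ∣ p ∣ → Nonempty p
∣p∣>0⇒nonempty (true ∷ p)  _   = zero , here
∣p∣>0⇒nonempty (false ∷ p) pos with ∣p∣>0⇒nonempty p pos
... | x , x∈p = suc x , there x∈p

independent-⁅⁆ : ∀ (H : Graph) v → Independent H ⁅ v ⁆
independent-⁅⁆ H v x y x∈ y∈ rewrite x∈⁅y⁆⇒x≡y v x∈ | x∈⁅y⁆⇒x≡y v y∈ = adj-irrefl H v

independent-∪⁅⁆ : ∀ (H : Graph) {S u} → Independent H S → (∀ v → v ∈ S → adj H v u ≡ false) →
                  Independent H (S ∪ ⁅ u ⁆)
independent-∪⁅⁆ H {S} {u} indS u-away x y x∈ y∈ with x∈p∪q⁻ S ⁅ u ⁆ x∈ | x∈p∪q⁻ S ⁅ u ⁆ y∈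
... | inj₁ x∈S | inj₁ y∈S = indS x y x∈S y∈S
... | inj₁ x∈S | inj₂ y∈u rewrite x∈⁅y⁆⇒x≡y u y∈u = u-away x x∈S
... | inj₂ x∈u | inj₁ y∈S rewrite x∈⁅y⁆⇒x≡y u x∈u = trans (adj-sym H u y) (u-away y y∈S)
... | inj₂ x∈u | inj₂ y∈u = independent-⁅⁆ H u x y x∈u y∈u

AlphaInducedAbove : (H : Graph) → Subset (n H) → ℕ → Set
AlphaInducedAbove H B k = ∃[ S ] (S ⊆ B × Independent H S × k < ∣ S ∣)

alphaAbove⇒¬alphaAtMost : ∀ {H B k j} → AlphaInducedAbove H B k → j ≤ k → ¬ AlphaInducedAtMost H B j
alphaAbove⇒¬alphaAtMost (S , S⊆B , indS , k<∣S∣) j≤k α≤j = <⇒≱ k<∣S∣ (≤-trans (α≤j S S⊆B indS) j≤k)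

¬alphaAbove⇒alphaAtMost : ∀ {H B k} → ¬ AlphaInducedAbove H B k → AlphaInducedAtMost H B k
¬alphaAbove⇒alphaAtMost {k = k} ¬above S S⊆B indS with ∣ S ∣ ≤? k
... | yes ∣S∣≤k = ∣S∣≤k
... | no ∣S∣≰k = ⊥-elim (¬above (S , S⊆B , indS , ≰⇒> ∣S∣≰k))

alphaAbove⇒nonempty : ∀ {H B k} → AlphaInducedAbove H B k → ∃[ v ] v ∈ B
alphaAbove⇒nonempty (S , S⊆B , _ , k<∣S∣) with ∣p∣>0⇒nonempty S (≤-trans (s≤s z≤n) k<∣S∣)
... | v , v∈S = v , S⊆B v∈S

HasBagAbove : {H : Graph} → PathDecomposition H → ℕ → Set
HasBagAbove {H} D k = ∃[ x ] AlphaInducedAbove H (bag D x) k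

-- Constructively we only get the double negation: exhibiting the bag would need a search.
minimal⇒¬¬bagAbove : ∀ {H k} → (∀ (D : PathDecomposition H) j → j < suc k → ¬ AlphaWidthAtMost D j) →
                     ∀ D → ¬ ¬ HasBagAbove D k
minimal⇒¬¬bagAbove {H} {k} minimal D noWide =
  minimal D k ≤-refl (λ x → ¬alphaAbove⇒alphaAtMost {H} (λ above → noWide (x , above)))

¬AlphaWidthAtMost-zero : ∀ {H} (D : PathDecomposition H) → Fin (n H) → ¬ AlphaWidthAtMost D 0
¬AlphaWidthAtMost-zero {H} D v width0 with vertex-cover D v
... | x , v∈ = alphaAbove⇒¬alphaAtMost {H} (⁅ v ⁆ , ⊆v , independent-⁅⁆ H v , ∣⁅v⁆∣>0) z≤n (width0 x)
  where
  ⊆v : ⁅ v ⁆ ⊆ bag D x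
  ⊆v y∈ rewrite x∈⁅y⁆⇒x≡y v y∈ = v∈
  ∣⁅v⁆∣>0 : 0 < ∣ ⁅ v ⁆ ∣
  ∣⁅v⁆∣>0 rewrite ∣⁅x⁆∣≡1 v = s≤s z≤n

Between : ∀ {a} → Fin a → Fin a → Fin a → Set
Between s z t = (s Fin.≤ z × z Fin.≤ t) ⊎ (t Fin.≤ z × z Fin.≤ s)

between-split : ∀ {a} {s z t : Fin a} y → Between s z t → Between s z y ⊎ Between y z t
between-split {z = z} y (inj₁ (s≤z , z≤t)) with ≤-total z y
... | inj₁ z≤y = inj₁ (inj₁ (s≤z , z≤y))
... | inj₂ y≤z = inj₂ (inj₁ (y≤z , z≤t))
between-split {z = z} y (inj₂ (t≤z , z≤s)) with ≤-total z y
... | inj₁ z≤y = inj₂ (inj₂ (t≤z , z≤y))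
... | inj₂ y≤z = inj₁ (inj₂ (y≤z , z≤s))

middle-of-three : ∀ {a} (x y z : Fin a) → Between y x z ⊎ Between x y z ⊎ Between x z y
middle-of-three x y z with ≤-total x y | ≤-total y z | ≤-total x z
... | inj₁ x≤y | inj₁ y≤z | _       = inj₂ (inj₁ (inj₁ (x≤y , y≤z)))
... | inj₁ x≤y | inj₂ z≤y | inj₁ x≤z = inj₂ (inj₂ (inj₁ (x≤z , z≤y)))
... | inj₁ x≤y | inj₂ z≤y | inj₂ z≤x = inj₁ (inj₂ (z≤x , x≤y))
... | inj₂ y≤x | _       | inj₁ x≤z = inj₁ (inj₁ (y≤x , x≤z))
... | inj₂ y≤x | inj₁ y≤z | inj₂ z≤x = inj₂ (inj₂ (inj₂ (y≤z , z≤x)))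
... | inj₂ y≤x | inj₂ z≤y | inj₂ _   = inj₂ (inj₁ (inj₂ (z≤y , y≤x)))

∈-between : ∀ {H} (D : PathDecomposition H) {v s z t} →
            v ∈ bag D s → v ∈ bag D t → Between s z t → v ∈ bag D z
∈-between D v∈s v∈t (inj₁ (s≤z , z≤t)) = contiguous D _ _ _ _ s≤z z≤t v∈s v∈t
∈-between D v∈s v∈t (inj₂ (t≤z , z≤s)) = contiguous D _ _ _ _ t≤z z≤s v∈t v∈s

data Walk (H : Graph) (P : Fin (n H) → Set) : Fin (n H) → Fin (n H) → Set where
  [_] : ∀ {p} → P p → Walk H P p p
  _∷⟨_⟩_ : ∀ {p q r} → P p → adj H p q ≡ true → Walk H P q r → Walk H P p r

infixr 5 _∷⟨_⟩_

walk-meets-between : ∀ {H P p r} (D : PathDecomposition H) → Walk H P p r → ∀ {s z t} →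
                     p ∈ bag D s → r ∈ bag D t → Between s z t → ∃[ u ] (P u × u ∈ bag D z)
walk-meets-between {p = p} D [ Pp ] p∈ r∈ btw = p , Pp , ∈-between D p∈ r∈ btw
walk-meets-between {p = p} D (_∷⟨_⟩_ {q = q} Pp pq walk) {s} {z} {t} p∈ r∈ btw with edge-cover D p q pq
... | y , p∈y , q∈y with between-split y btw
...   | inj₁ btw-sy = p , Pp , ∈-between D p∈ p∈y btw-sy
...   | inj₂ btw-yt = walk-meets-between D walk q∈y r∈ btw-yt

preimage : ∀ {a b} → (Fin a → Fin b) → Subset b → Subset a
preimage f S = tabulate (λ v → lookup S (f v))

∈-preimage⁺ : ∀ {a b} {f : Fin a → Fin b} {S v} → f v ∈ S → v ∈ preimage f S
∈-preimage⁺ fv∈S = ∈-tabulate⁺ ([]=⇒lookup fv∈S)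

∈-preimage⁻ : ∀ {a b} {f : Fin a → Fin b} {S v} → v ∈ preimage f S → f v ∈ S
∈-preimage⁻ {f = f} {S} {v} v∈ = lookup⇒[]= (f v) S (∈-tabulate⁻ v∈)

IsHomomorphism : (G H : Graph) → (Fin (n G) → Fin (n H)) → Set
IsHomomorphism G H f = ∀ u v → adj G u v ≡ true → adj H (f u) (f v) ≡ true

preimage-independent : ∀ {G H f} → IsHomomorphism G H f → ∀ {S} → Independent H S → Independent G (preimage f S)
preimage-independent {G} {H} {f} hom indS u v u∈ v∈ with adj G u v in uv
... | false = refl
... | true with () ← trans (sym (hom u v uv)) (indS (f u) (f v) (∈-preimage⁻ u∈) (∈-preimage⁻ v∈))

pullback : ∀ {G H} (f : Fin (n G) → Fin (n H)) → IsHomomorphism G H f → PathDecomposition H → PathDecomposition G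
pullback f hom D = record
  { len          = len D
  ; bag          = λ x → preimage f (bag D x)
  ; vertex-cover = λ v → map₂ ∈-preimage⁺ (vertex-cover D (f v))
  ; edge-cover   = λ u v uv → map₂ (map ∈-preimage⁺ ∈-preimage⁺) (edge-cover D (f u) (f v) (hom u v uv))
  ; contiguous   = λ v x y z x≤y y≤z v∈x v∈z →
                     ∈-preimage⁺ (contiguous D (f v) x y z x≤y y≤z (∈-preimage⁻ v∈x) (∈-preimage⁻ v∈z))
  }

module _ {m : ℕ} (b : ℕ) where

  toℕ-quotient-remainder : ∀ (x : Fin (m * b)) → toℕ x ≡ b * toℕ (quotient {m} b x) + toℕ (remainder {m} b x)
  toℕ-quotient-remainder x =
    trans (cong toℕ (sym (combine-remQuot {m} b x))) (toℕ-combine (quotient {m} b x) (remainder {m} b x))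

  quotient-mono : ∀ {x y : Fin (m * b)} → x Fin.≤ y → quotient {m} b x Fin.≤ quotient {m} b y
  quotient-mono {x} {y} x≤y with toℕ (quotient {m} b x) ≤? toℕ (quotient {m} b y)
  ... | yes q≤ = q≤
  ... | no q≰ = ⊥-elim (<⇒≱ y<x x≤y)
    where
    y<x : y Fin.< x
    y<x = subst₂ Fin._<_ (combine-remQuot {m} b y) (combine-remQuot {m} b x)
            (combine-monoˡ-< (remainder {m} b y) (remainder {m} b x) (≰⇒> q≰))

  quotient-convex : ∀ {x y z : Fin (m * b)} → x Fin.≤ y → y Fin.≤ z →
                    quotient {m} b x ≡ quotient {m} b z → quotient {m} b y ≡ quotient {m} b x
  quotient-convex x≤y y≤z qx≡qz =
    ≤-antisym (subst (_ Fin.≤_) (sym qx≡qz) (quotient-mono y≤z)) (quotient-mono x≤y)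

  remainder-mono : ∀ {x y : Fin (m * b)} → quotient {m} b x ≡ quotient {m} b y → x Fin.≤ y →
                   remainder {m} b x Fin.≤ remainder {m} b y
  remainder-mono {x} {y} qx≡qy x≤y =
    +-cancelˡ-≤ (b * toℕ (quotient {m} b x)) _ _
      (subst₂ _≤_ (toℕ-quotient-remainder x)
         (trans (toℕ-quotient-remainder y) (cong (λ q → b * toℕ q + _) (sym qx≡qy))) x≤y)

same-refl : ∀ c → same c c ≡ true
same-refl c₁ = refl
same-refl c₂ = refl
same-refl c₃ = refl

∧≡true⁻ : ∀ {a b} → a ∧ b ≡ true → a ≡ true × b ≡ true
∧≡true⁻ {true} {true} refl = refl , refl

same⇒≡ : ∀ {c d} → same c d ≡ true → c ≡ d
same⇒≡ {c₁} {c₁} _ = refl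
same⇒≡ {c₂} {c₂} _ = refl
same⇒≡ {c₃} {c₃} _ = refl

toThree : Fin 3 → Three
toThree zero             = c₁
toThree (suc zero)       = c₂
toThree (suc (suc zero)) = c₃

fromThree : Three → Fin 3
fromThree c₁ = zero
fromThree c₂ = suc zero
fromThree c₃ = suc (suc zero)

toThree-fromThree : ∀ c → toThree (fromThree c) ≡ c
toThree-fromThree c₁ = refl
toThree-fromThree c₂ = refl
toThree-fromThree c₃ = refl

fromThree-toThree : ∀ i → fromThree (toThree i) ≡ i
fromThree-toThree zero             = refl
fromThree-toThree (suc zero)       = refl
fromThree-toThree (suc (suc zero)) = refl

toThree-injective : ∀ {i j} → toThree i ≡ toThree j → i ≡ j
toThree-injective {i} {j} eq = trans (sym (fromThree-toThree i)) (trans (cong fromThree eq) (fromThree-toThree j))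

encode : ∀ {m} → SVertex m → Fin (m + m + m + 4)
encode {m} (copy c₁ v) = ((v ↑ˡ m) ↑ˡ m) ↑ˡ 4
encode {m} (copy c₂ v) = ((m ↑ʳ v) ↑ˡ m) ↑ˡ 4
encode {m} (copy c₃ v) = ((m + m) ↑ʳ v) ↑ˡ 4
encode {m} (hub c₁)    = (m + m + m) ↑ʳ zero
encode {m} (hub c₂)    = (m + m + m) ↑ʳ suc zero
encode {m} (hub c₃)    = (m + m + m) ↑ʳ suc (suc zero)
encode {m} centre      = (m + m + m) ↑ʳ suc (suc (suc zero))

decode-encode : ∀ m (x : SVertex m) → decode m (encode x) ≡ x
decode-encode m (copy c₁ v)
  rewrite splitAt-↑ˡ (m + m + m) ((v ↑ˡ m) ↑ˡ m) 4 | splitAt-↑ˡ (m + m) (v ↑ˡ m) m | splitAt-↑ˡ m v m = refl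
decode-encode m (copy c₂ v)
  rewrite splitAt-↑ˡ (m + m + m) ((m ↑ʳ v) ↑ˡ m) 4 | splitAt-↑ˡ (m + m) (m ↑ʳ v) m | splitAt-↑ʳ m m v = refl
decode-encode m (copy c₃ v)
  rewrite splitAt-↑ˡ (m + m + m) ((m + m) ↑ʳ v) 4 | splitAt-↑ʳ (m + m) m v = refl
decode-encode m (hub c₁) rewrite splitAt-↑ʳ (m + m + m) 4 zero = refl
decode-encode m (hub c₂) rewrite splitAt-↑ʳ (m + m + m) 4 (suc zero) = refl
decode-encode m (hub c₃) rewrite splitAt-↑ʳ (m + m + m) 4 (suc (suc zero)) = refl
decode-encode m centre   rewrite splitAt-↑ʳ (m + m + m) 4 (suc (suc (suc zero))) = refl

encode-decode : ∀ m (y : Fin (m + m + m + 4)) → encode (decode m y) ≡ y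
encode-decode m y with splitAt (m + m + m) y in eq₁
... | inj₂ zero                   = splitAt⁻¹-↑ʳ eq₁
... | inj₂ (suc zero)             = splitAt⁻¹-↑ʳ eq₁
... | inj₂ (suc (suc zero))       = splitAt⁻¹-↑ʳ eq₁
... | inj₂ (suc (suc (suc zero))) = splitAt⁻¹-↑ʳ eq₁
... | inj₁ y₁ with splitAt (m + m) y₁ in eq₂
...   | inj₂ v = trans (cong (_↑ˡ 4) (splitAt⁻¹-↑ʳ eq₂)) (splitAt⁻¹-↑ˡ eq₁)
...   | inj₁ y₂ with splitAt m y₂ in eq₃
...     | inj₁ v = trans (cong (λ t → (t ↑ˡ m) ↑ˡ 4) (splitAt⁻¹-↑ˡ eq₃))
                     (trans (cong (_↑ˡ 4) (splitAt⁻¹-↑ˡ eq₂)) (splitAt⁻¹-↑ˡ eq₁))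
...     | inj₂ v = trans (cong (λ t → (t ↑ˡ m) ↑ˡ 4) (splitAt⁻¹-↑ʳ eq₃))
                     (trans (cong (_↑ˡ 4) (splitAt⁻¹-↑ˡ eq₂)) (splitAt⁻¹-↑ˡ eq₁))

module Claw (G : Graph) where

  SG : Graph
  SG = sClaw G

  adj-encode : ∀ x y → adj SG (encode x) (encode y) ≡ sAdjV G x y
  adj-encode x y rewrite decode-encode (n G) x | decode-encode (n G) y = refl

  embed : Three → Fin (n G) → Fin (n SG)
  embed c v = encode (copy c v)

  embed-homomorphism : ∀ c → IsHomomorphism G SG (embed c)
  embed-homomorphism c u v uv rewrite adj-encode (copy c u) (copy c v) | same-refl c = uv

  onlyAt : Three → Subset (n G) → Three → Subset (n G)
  onlyAt c S d = if same c d then S else ∅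

  copySubset : Three → Subset (n G) → Subset (n SG)
  copySubset c S = ((onlyAt c S c₁ ++ onlyAt c S c₂) ++ onlyAt c S c₃) ++ ∅

  inCopy : Three → Subset (n G) → SVertex (n G) → Bool
  inCopy c S (copy d v) = same c d ∧ lookup S v
  inCopy c S (hub d)    = false
  inCopy c S centre     = false

  lookup-onlyAt : ∀ c S d v → lookup (onlyAt c S d) v ≡ (same c d ∧ lookup S v)
  lookup-onlyAt c S d v with same c d
  ... | true  = refl
  ... | false = lookup-replicate v false

  lookup-copySubset-corner : ∀ c S (i : Fin 4) → lookup (copySubset c S) ((n G + n G + n G) ↑ʳ i) ≡ false
  lookup-copySubset-corner c S i =
    trans (lookup-++ʳ ((onlyAt c S c₁ ++ onlyAt c S c₂) ++ onlyAt c S c₃) ∅ i) (lookup-replicate i false)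

  lookup-copySubset : ∀ c S x → lookup (copySubset c S) (encode x) ≡ inCopy c S x
  lookup-copySubset c S (copy c₁ v) =
    trans (lookup-++ˡ ((A ++ B) ++ C) ∅ _) (trans (lookup-++ˡ (A ++ B) C _) (trans (lookup-++ˡ A B v) (lookup-onlyAt c S c₁ v)))
    where A = onlyAt c S c₁; B = onlyAt c S c₂; C = onlyAt c S c₃
  lookup-copySubset c S (copy c₂ v) =
    trans (lookup-++ˡ ((A ++ B) ++ C) ∅ _) (trans (lookup-++ˡ (A ++ B) C _) (trans (lookup-++ʳ A B v) (lookup-onlyAt c S c₂ v)))
    where A = onlyAt c S c₁; B = onlyAt c S c₂; C = onlyAt c S c₃
  lookup-copySubset c S (copy c₃ v) =
    trans (lookup-++ˡ ((A ++ B) ++ C) ∅ _) (trans (lookup-++ʳ (A ++ B) C v) (lookup-onlyAt c S c₃ v))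
    where A = onlyAt c S c₁; B = onlyAt c S c₂; C = onlyAt c S c₃
  lookup-copySubset c S (hub c₁) = lookup-copySubset-corner c S _
  lookup-copySubset c S (hub c₂) = lookup-copySubset-corner c S _
  lookup-copySubset c S (hub c₃) = lookup-copySubset-corner c S _
  lookup-copySubset c S centre   = lookup-copySubset-corner c S _

  ∈-copySubset⁺ : ∀ c {S v} → v ∈ S → embed c v ∈ copySubset c S
  ∈-copySubset⁺ c {S} {v} v∈S =
    lookup⇒[]= _ _ (trans (lookup-copySubset c S (copy c v)) (trans (cong (_∧ lookup S v) (same-refl c)) ([]=⇒lookup v∈S)))

  ∈-copySubset⁻ : ∀ c {S y} → y ∈ copySubset c S → ∃[ v ] (y ≡ embed c v × v ∈ S)
  ∈-copySubset⁻ c {S} {y} y∈ = inCopy⇒ (decode (n G) y) (encode-decode (n G) y)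
    (trans (sym (lookup-copySubset c S (decode (n G) y))) (trans (cong (lookup (copySubset c S)) (encode-decode (n G) y)) ([]=⇒lookup y∈)))
    where
    inCopy⇒ : ∀ x → encode x ≡ y → inCopy c S x ≡ true → ∃[ v ] (y ≡ embed c v × v ∈ S)
    inCopy⇒ (copy d v) refl cdv with same c d in cd
    ... | true with refl ← same⇒≡ cd = v , refl , lookup⇒[]= v S cdv

  ∣copySubset∣ : ∀ c S → ∣ copySubset c S ∣ ≡ ∣ S ∣
  ∣copySubset∣ c S = trans (∣blocks∣ (onlyAt c S c₁) (onlyAt c S c₂) (onlyAt c S c₃)) (sizes c)
    where
    ∣blocks∣ : ∀ (A B C : Subset (n G)) → ∣ ((A ++ B) ++ C) ++ ∅ {4} ∣ ≡ ∣ A ∣ + ∣ B ∣ + ∣ C ∣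
    ∣blocks∣ A B C rewrite ∣p++q∣≡∣p∣+∣q∣ ((A ++ B) ++ C) (∅ {4}) | ∣p++q∣≡∣p∣+∣q∣ (A ++ B) C | ∣p++q∣≡∣p∣+∣q∣ A B
                         | ∣⊥∣≡0 4 = +-identityʳ _
    sizes : ∀ c → ∣ onlyAt c S c₁ ∣ + ∣ onlyAt c S c₂ ∣ + ∣ onlyAt c S c₃ ∣ ≡ ∣ S ∣
    sizes c₁ rewrite ∣⊥∣≡0 (n G) = trans (+-identityʳ _) (+-identityʳ _)
    sizes c₂ rewrite ∣⊥∣≡0 (n G) = +-identityʳ _
    sizes c₃ rewrite ∣⊥∣≡0 (n G) = refl

  copySubset-independent : ∀ c {S} → Independent G S → Independent SG (copySubset c S)
  copySubset-independent c {S} indS y z y∈ z∈ with ∈-copySubset⁻ c y∈ | ∈-copySubset⁻ c z∈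
  ... | v , refl , v∈S | w , refl , w∈S rewrite adj-encode (copy c v) (copy c w) | same-refl c = indS v w v∈S w∈S

  restrictToCopy : Three → PathDecomposition SG → PathDecomposition G
  restrictToCopy c = pullback (embed c) (embed-homomorphism c)

  AwayFrom : Three → SVertex (n G) → Set
  AwayFrom c (copy d v) = same d c ≡ false
  AwayFrom c (hub d)    = same d c ≡ false
  AwayFrom c centre     = ⊤

  away⇒nonadjacent : ∀ c x → AwayFrom c x → ∀ v → sAdjV G x (copy c v) ≡ false
  away⇒nonadjacent c (copy d w) d≢c v rewrite d≢c = refl
  away⇒nonadjacent c (hub d)    d≢c v = d≢c
  away⇒nonadjacent c centre     _   v = refl

  away⇒≢copy : ∀ c {x} v → AwayFrom c x → x ≢ copy c v
  away⇒≢copy c v c≢c refl with () ← trans (sym (same-refl c)) c≢c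

  AwayFromᵛ : Three → Fin (n SG) → Set
  AwayFromᵛ c y = AwayFrom c (decode (n G) y)

  walkAround : ∀ {i j l} → same i j ≡ false → same l j ≡ false → ∀ a b → Walk SG (AwayFromᵛ j) (embed i a) (embed l b)
  walkAround {i} {j} {l} i≢j l≢j a b =
    away (copy i a) i≢j ∷⟨ edge (copy i a) (hub i) (same-refl i) ⟩
    away (hub i) i≢j    ∷⟨ edge (hub i) centre refl ⟩
    away centre tt      ∷⟨ edge centre (hub l) refl ⟩
    away (hub l) l≢j    ∷⟨ edge (hub l) (copy l b) (same-refl l) ⟩
    [ away (copy l b) l≢j ]
    where
    away : ∀ x → AwayFrom j x → AwayFromᵛ j (encode x)
    away x = subst (AwayFrom j) (sym (decode-encode (n G) x))
    edge : ∀ x y → sAdjV G x y ≡ true → adj SG (encode x) (encode y) ≡ true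
    edge x y xy = trans (adj-encode x y) xy

  module _ (D : PathDecomposition SG) where

    ∈-restrictToCopy⁻ : ∀ {c x v} → v ∈ bag (restrictToCopy c D) x → embed c v ∈ bag D x
    ∈-restrictToCopy⁻ = ∈-preimage⁻

    extendByAway : ∀ {c x u k} → u ∈ bag D x → AwayFromᵛ c u →
                   AlphaInducedAbove G (bag (restrictToCopy c D) x) k → AlphaInducedAbove SG (bag D x) (suc k)
    extendByAway {c} {x} {u} {k} u∈x away (S , S⊆ , indS , k<∣S∣) =
      T , T⊆ , independent-∪⁅⁆ SG (copySubset-independent c indS) u-nonadjacent , ∣T∣>suc-k
      where
      T : Subset (n SG)
      T = copySubset c S ∪ ⁅ u ⁆
      T⊆ : T ⊆ bag D x
      T⊆ y∈ with x∈p∪q⁻ (copySubset c S) ⁅ u ⁆ y∈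
      ... | inj₁ y∈S′ with ∈-copySubset⁻ c y∈S′
      ...   | v , refl , v∈S = ∈-restrictToCopy⁻ {c} (S⊆ v∈S)
      T⊆ y∈ | inj₂ y∈u rewrite x∈⁅y⁆⇒x≡y u y∈u = u∈x
      u-nonadjacent : ∀ y → y ∈ copySubset c S → adj SG y u ≡ false
      u-nonadjacent y y∈ with ∈-copySubset⁻ c y∈
      ... | v , refl , _ = begin
        adj SG (embed c v) u                     ≡⟨ cong (adj SG (embed c v)) (sym (encode-decode (n G) u)) ⟩
        adj SG (embed c v) (encode (decode (n G) u)) ≡⟨ adj-encode (copy c v) (decode (n G) u) ⟩
        sAdjV G (copy c v) (decode (n G) u)       ≡⟨ sAdjV-sym G (copy c v) (decode (n G) u) ⟩
        sAdjV G (decode (n G) u) (copy c v)       ≡⟨ away⇒nonadjacent c (decode (n G) u) away v ⟩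
        false                                    ∎
      u∉ : u ∉ copySubset c S
      u∉ u∈ with ∈-copySubset⁻ c u∈
      ... | v , u≡v , _ = away⇒≢copy c v away (trans (cong (decode (n G)) u≡v) (decode-encode (n G) (copy c v)))
      ∣T∣>suc-k : suc k < ∣ T ∣
      ∣T∣>suc-k = ≤-trans (s≤s (subst (k <_) (sym (∣copySubset∣ c S)) k<∣S∣)) (x∉p⇒∣p∣<∣p∪⁅x⁆∣ u∉)

    copyVertex : ∀ {c x k} → AlphaInducedAbove G (bag (restrictToCopy c D) x) k → ∃[ v ] embed c v ∈ bag D x
    copyVertex {c} above with alphaAbove⇒nonempty {G} above
    ... | v , v∈ = v , ∈-restrictToCopy⁻ {c} v∈

    aboveAtMiddle : ∀ {i j l xᵢ xⱼ xₗ k} → same i j ≡ false → same l j ≡ false →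
                    AlphaInducedAbove G (bag (restrictToCopy i D) xᵢ) k →
                    AlphaInducedAbove G (bag (restrictToCopy j D) xⱼ) k →
                    AlphaInducedAbove G (bag (restrictToCopy l D) xₗ) k → Between xᵢ xⱼ xₗ →
                    AlphaInducedAbove SG (bag D xⱼ) (suc k)
    aboveAtMiddle {i} {j} {l} i≢j l≢j aboveᵢ aboveⱼ aboveₗ btw with copyVertex {i} aboveᵢ | copyVertex {l} aboveₗ
    ... | a , a∈ | b , b∈ with walk-meets-between D (walkAround i≢j l≢j a b) a∈ b∈ btw
    ... | u , away , u∈ = extendByAway {j} u∈ away aboveⱼ

    threeCopiesAbove : ∀ {k} → HasBagAbove (restrictToCopy c₁ D) k → HasBagAbove (restrictToCopy c₂ D) k →
                       HasBagAbove (restrictToCopy c₃ D) k → HasBagAbove D (suc k)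
    threeCopiesAbove (x₁ , above₁) (x₂ , above₂) (x₃ , above₃) with middle-of-three x₁ x₂ x₃
    ... | inj₁ btw        = x₁ , aboveAtMiddle {c₂} {c₁} {c₃} refl refl above₂ above₁ above₃ btw
    ... | inj₂ (inj₁ btw) = x₂ , aboveAtMiddle {c₁} {c₂} {c₃} refl refl above₁ above₂ above₃ btw
    ... | inj₂ (inj₂ btw) = x₃ , aboveAtMiddle {c₁} {c₃} {c₂} refl refl above₁ above₃ above₂ btw

  alphaPw-lower : ∀ k → (∀ (D : PathDecomposition G) j → j < k → ¬ AlphaWidthAtMost D j) →
                  ∀ (D : PathDecomposition SG) j → j < suc k → ¬ AlphaWidthAtMost D j
  alphaPw-lower zero    _       D .zero (s≤s z≤n) = ¬AlphaWidthAtMost-zero D (encode {n G} centre)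
  alphaPw-lower (suc k) minimal D j (s≤s j≤k) width =
    minimal⇒¬¬bagAbove minimal (restrictToCopy c₁ D) λ above₁ →
    minimal⇒¬¬bagAbove minimal (restrictToCopy c₂ D) λ above₂ →
    minimal⇒¬¬bagAbove minimal (restrictToCopy c₃ D) λ above₃ →
    narrow (threeCopiesAbove D above₁ above₂ above₃)
    where
    narrow : ¬ HasBagAbove D (suc k)
    narrow (x , above) = alphaAbove⇒¬alphaAtMost {SG} above j≤k (width x)

  module _ (D : PathDecomposition G) where

    inClawBag : Three → Fin (suc (len D)) → SVertex (n G) → Bool
    inClawBag c a (copy d v) = same c d ∧ lookup (bag D a) v
    inClawBag c a (hub d)    = same c d
    inClawBag c a centre     = true

    clawBag : Three → Fin (suc (len D)) → Subset (n SG)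
    clawBag c a = tabulate (λ y → inClawBag c a (decode (n G) y))

    ∈-clawBag⁻ : ∀ {c a y} → y ∈ clawBag c a →
                 (∃[ v ] (y ≡ embed c v × v ∈ bag D a)) ⊎ y ≡ encode {n G} (hub c) ⊎ y ≡ encode {n G} centre
    ∈-clawBag⁻ {c} {a} {y} y∈ = cases (decode (n G) y) (sym (encode-decode (n G) y)) (∈-tabulate⁻ y∈)
      where
      cases : ∀ x → y ≡ encode x → inClawBag c a x ≡ true →
              (∃[ v ] (y ≡ embed c v × v ∈ bag D a)) ⊎ y ≡ encode {n G} (hub c) ⊎ y ≡ encode {n G} centre
      cases (copy d v) y≡ c∧v with same c d in cd
      ... | true with refl ← same⇒≡ cd = inj₁ (v , y≡ , lookup⇒[]= v (bag D a) c∧v)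
      cases (hub d) y≡ cd with refl ← same⇒≡ cd = inj₂ (inj₁ y≡)
      cases centre y≡ _ = inj₂ (inj₂ y≡)

    ∈-clawBag-copy⁻ : ∀ {c a v} → embed c v ∈ clawBag c a → v ∈ bag D a
    ∈-clawBag-copy⁻ {c} {a} {v} v∈ = lookup⇒[]= v (bag D a) (begin
      lookup (bag D a) v                          ≡⟨ cong (_∧ lookup (bag D a) v) (same-refl c) ⟨
      inClawBag c a (copy c v)                    ≡⟨ cong (inClawBag c a) (decode-encode (n G) (copy c v)) ⟨
      inClawBag c a (decode (n G) (embed c v))    ≡⟨ ∈-tabulate⁻ v∈ ⟩
      true                                        ∎)

    clawBag-alpha : ∀ {k} → AlphaWidthAtMost D k → ∀ c a → AlphaInducedAtMost SG (clawBag c a) (suc k)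
    clawBag-alpha {k} width c a S S⊆B indS with encode {n G} (hub c) ∈? S
    ... | yes hub∈S = ≤-trans (p⊆q⇒∣p∣≤∣q∣ S⊆⁅hub⁆) (subst (_≤ suc k) (sym (∣⁅x⁆∣≡1 (encode {n G} (hub c)))) (s≤s z≤n))
      where
      hub-nonadjacent : ∀ x → encode x ∈ S → sAdjV G (hub c) x ≡ false
      hub-nonadjacent x x∈ = trans (sym (adj-encode (hub c) x)) (indS _ _ hub∈S x∈)
      S⊆⁅hub⁆ : S ⊆ ⁅ encode {n G} (hub c) ⁆
      S⊆⁅hub⁆ y∈ with ∈-clawBag⁻ {c} {a} (S⊆B y∈)
      ... | inj₁ (v , refl , _) with () ← trans (sym (same-refl c)) (hub-nonadjacent (copy c v) y∈)
      ... | inj₂ (inj₁ refl)     = x∈⁅x⁆ _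
      ... | inj₂ (inj₂ refl) with () ← hub-nonadjacent centre y∈
    ... | no hub∉S = ≤-trans (p⊆q⇒∣p∣≤∣q∣ S⊆) (≤-trans (∣p∪q∣≤∣p∣+∣q∣ (copySubset c P) ⁅ encode {n G} centre ⁆) bound)
      where
      P : Subset (n G)
      P = preimage (embed c) S
      S⊆ : S ⊆ copySubset c P ∪ ⁅ encode {n G} centre ⁆
      S⊆ y∈ with ∈-clawBag⁻ {c} {a} (S⊆B y∈)
      ... | inj₁ (v , refl , _) = x∈p∪q⁺ (inj₁ (∈-copySubset⁺ c (∈-preimage⁺ y∈)))
      ... | inj₂ (inj₁ refl)     = ⊥-elim (hub∉S y∈)
      ... | inj₂ (inj₂ refl)     = x∈p∪q⁺ (inj₂ (x∈⁅x⁆ _))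
      ∣P∣≤k : ∣ P ∣ ≤ k
      ∣P∣≤k = width a P (λ v∈ → ∈-clawBag-copy⁻ {c} {a} (S⊆B (∈-preimage⁻ {f = embed c} v∈)))
                        (preimage-independent {G} {SG} (embed-homomorphism c) indS)
      bound : ∣ copySubset c P ∣ + ∣ ⁅ encode {n G} centre ⁆ ∣ ≤ suc k
      bound rewrite ∣copySubset∣ c P | ∣⁅x⁆∣≡1 (encode {n G} centre) | +-comm ∣ P ∣ 1 = s≤s ∣P∣≤k

    -- The path of the new decomposition runs through D once for each copy G_c, in the order c₁, c₂, c₃.
    segment : Fin (3 * suc (len D)) → Three
    segment x = toThree (quotient {3} (suc (len D)) x)

    position : Fin (3 * suc (len D)) → Fin (suc (len D))
    position x = remainder {3} (suc (len D)) x

    nodeAt : Three → Fin (suc (len D)) → Fin (3 * suc (len D))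
    nodeAt c a = combine (fromThree c) a

    segment-nodeAt : ∀ c a → segment (nodeAt c a) ≡ c × position (nodeAt c a) ≡ a
    segment-nodeAt c a =
      trans (cong (toThree ∘ proj₁) (remQuot-combine (fromThree c) a)) (toThree-fromThree c) ,
      cong proj₂ (remQuot-combine (fromThree c) a)

    InBagAt : Fin (3 * suc (len D)) → SVertex (n G) → Set
    InBagAt x v = inClawBag (segment x) (position x) v ≡ true

    inBagAt-nodeAt : ∀ {c a} v → inClawBag c a v ≡ true → InBagAt (nodeAt c a) v
    inBagAt-nodeAt {c} {a} _ v∈ with segment-nodeAt c a
    ... | seg≡ , pos≡ rewrite seg≡ | pos≡ = v∈

    inClawBag-copy : ∀ {c a v} → v ∈ bag D a → inClawBag c a (copy c v) ≡ true
    inClawBag-copy {c} {a} {v} v∈ = trans (cong (_∧ lookup (bag D a) v) (same-refl c)) ([]=⇒lookup v∈)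

    coverVertex : ∀ x → ∃[ c ] ∃[ a ] inClawBag c a x ≡ true
    coverVertex (copy c v) with vertex-cover D v
    ... | a , v∈ = c , a , inClawBag-copy v∈
    coverVertex (hub c) = c , zero , same-refl c
    coverVertex centre  = c₁ , zero , refl

    coverEdge : ∀ x y → sAdjV G x y ≡ true → ∃[ c ] ∃[ a ] (inClawBag c a x ≡ true × inClawBag c a y ≡ true)
    coverEdge (copy c u) (copy d w) cd∧uw with same c d in cd
    ... | true with refl ← same⇒≡ cd with edge-cover D u w cd∧uw
    ...   | a , u∈ , w∈ = c , a , inClawBag-copy u∈ , inClawBag-copy w∈
    coverEdge (copy c u) (hub d) cd with refl ← same⇒≡ cd with vertex-cover D u
    ... | a , u∈ = c , a , inClawBag-copy u∈ , same-refl c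
    coverEdge (hub c) (copy d w) cd with refl ← same⇒≡ cd with vertex-cover D w
    ... | a , w∈ = c , a , same-refl c , inClawBag-copy w∈
    coverEdge (hub c) centre _ = c , zero , same-refl c , refl
    coverEdge centre (hub d) _ = d , zero , refl , same-refl d

    segment-convex : ∀ {x y z} → x Fin.≤ y → y Fin.≤ z → segment x ≡ segment z →
                     segment y ≡ segment x × position x Fin.≤ position y × position y Fin.≤ position z
    segment-convex x≤y y≤z seg-x≡z =
      cong toThree qy≡qx , remainder-mono L (sym qy≡qx) x≤y , remainder-mono L (trans qy≡qx qx≡qz) y≤z
      where
      L = suc (len D)
      qx≡qz = toThree-injective seg-x≡z
      qy≡qx = quotient-convex L x≤y y≤z qx≡qz

    inBagAt-convex : ∀ v {x y z} → x Fin.≤ y → y Fin.≤ z → InBagAt x v → InBagAt z v → InBagAt y v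
    inBagAt-convex centre  _ _ _ _ = refl
    inBagAt-convex (hub d) x≤y y≤z in-x in-z
      with segment-convex x≤y y≤z (trans (same⇒≡ in-x) (sym (same⇒≡ in-z)))
    ... | seg-y≡x , _ rewrite seg-y≡x = in-x
    inBagAt-convex (copy d w) {x} {y} {z} x≤y y≤z in-x in-z
      with ∧≡true⁻ {same (segment x) d} in-x | ∧≡true⁻ {same (segment z) d} in-z
    ... | seg-x , w∈x | seg-z , w∈z with segment-convex x≤y y≤z (trans (same⇒≡ seg-x) (sym (same⇒≡ seg-z)))
    ...   | seg-y≡x , px≤py , py≤pz rewrite seg-y≡x | seg-x =
      []=⇒lookup (contiguous D w _ _ _ px≤py py≤pz (lookup⇒[]= w _ w∈x) (lookup⇒[]= w _ w∈z))

    clawDecomposition : PathDecomposition SG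
    clawDecomposition = record
      { len          = len D + 2 * suc (len D)
      ; bag          = λ x → clawBag (segment x) (position x)
      ; vertex-cover = vertex-cover′
      ; edge-cover   = edge-cover′
      ; contiguous   = λ v x y z x≤y y≤z v∈x v∈z →
                         ∈-tabulate⁺ (inBagAt-convex (decode (n G) v) x≤y y≤z (∈-tabulate⁻ v∈x) (∈-tabulate⁻ v∈z))
      }
      where
      vertex-cover′ : ∀ v → ∃[ x ] v ∈ clawBag (segment x) (position x)
      vertex-cover′ v with coverVertex (decode (n G) v)
      ... | c , a , v∈ = nodeAt c a , ∈-tabulate⁺ (inBagAt-nodeAt {c} {a} (decode (n G) v) v∈)
      edge-cover′ : ∀ u v → adj SG u v ≡ true → ∃[ x ] (u ∈ clawBag (segment x) (position x) × v ∈ clawBag (segment x) (position x))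
      edge-cover′ u v uv with coverEdge (decode (n G) u) (decode (n G) v) uv
      ... | c , a , u∈ , v∈ = nodeAt c a , ∈-tabulate⁺ (inBagAt-nodeAt {c} {a} (decode (n G) u) u∈) , ∈-tabulate⁺ (inBagAt-nodeAt {c} {a} (decode (n G) v) v∈)

    clawDecomposition-alpha : ∀ {k} → AlphaWidthAtMost D k → AlphaWidthAtMost clawDecomposition (suc k)
    clawDecomposition-alpha width x = clawBag-alpha width (segment x) (position x)

theorem4p1 : (G : Graph) (k : ℕ) → AlphaPw G k → AlphaPw (sClaw G) (suc k)
theorem4p1 G k ((D , width) , minimal) =
  (clawDecomposition D , clawDecomposition-alpha D width) , alphaPw-lower k minimal
  where open Claw G
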